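{- Let $\mathcal{A}=(a_n)_{n\in\mathbb{N}_+}$ be a sequence of positive integers, $k\in\mathbb{N}_+$ and $m\geqslant 2$ an integer. Then there exist at most $\sum_{i=1}^k a_i-1$ consecutive values of $n\in\mathbb{N}$ such that $p_\mathcal{A}(n,k)\equiv 0\pmod{m}$; that is, there is no $n_0\in\mathbb{N}$ with $p_\mathcal{A}(n,k)\equiv0\pmod m$ for all $n\in\{n_0,n_0+1,\ldots,n_0+\sum_{i=1}^ka_i-1\}$.
   Context: $\mathbb{N}=\{0,1,2,\ldots\}$. For $k\in\mathbb{N}_+$ and $n\in\mathbb{N}$, $p_\mathcal{A}(n,k)$ is the number of tuples $(x_1,\ldots,x_k)\in\mathbb{N}^k$ with $a_1x_1+\cdots+a_kx_k=n$, i.e. $\sum_{n\ge0}p_\mathcal{A}(n,k)x^n=\prod_{i=1}^k(1-x^{a_i})^{ -1}$. -}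

module Defs where

open import Data.Nat using (ℕ; zero; suc; _+_; _*_; _∸_; _≤?_)
open import Relation.Nullary using (yes; no)

-- Sequences A = (a_1, a_2, ...) are represented as  a : ℕ → ℕ  with
-- a i  standing for  a_{i+1}  (0-based indexing of a 1-based sequence).

sumUpTo : ℕ → (ℕ → ℕ) → ℕ
sumUpTo zero    f = f 0
sumUpTo (suc n) f = sumUpTo n f + f (suc n)

-- pA a n k = number of tuples (x_1,...,x_k) ∈ ℕ^k with
-- a_1 x_1 + ... + a_k x_k = n.
pA : (ℕ → ℕ) → ℕ → ℕ → ℕ
pA a zero    zero    = 1
pA a (suc n) zero    = 0
pA a n       (suc k) = sumUpTo n λ x → term x
  where
  term : ℕ → ℕ
  term x with x * a k ≤? n
  ... | yes _ = pA a (n ∸ x * a k) k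
  ... | no  _ = 0

sumA : (ℕ → ℕ) → ℕ → ℕ
sumA a zero    = 0
sumA a (suc k) = sumA a k + a k

{-# OPTIONS --safe #-}
module Submission where

-- By the recurrence p(n, k+1) = p(n, k) + p(n − a_{k+1}, k+1) (for n ≥ a_{k+1}), a run of
-- a_1 + ⋯ + a_{k+1} consecutive values of p(·, k+1) divisible by m yields, by subtracting
-- values a_{k+1} apart, a run of a_1 + ⋯ + a_k consecutive values of p(·, k) divisible by m.
-- Descending to k = 1 leaves a run of a_1 consecutive values of p(n, 1) = [a_1 ∣ n]; such a
-- run contains a multiple of a_1, where the value is 1, which m ≥ 2 does not divide.

open import Defs
open import Data.Nat using (ℕ; zero; suc; _+_; _*_; _∸_; _<_; _≤_; _≤′_; _≤?_; z≤n; s≤s; ≤′-refl; ≤′-step; >-nonZero)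
open import Data.Nat.Properties
open import Data.Nat.Divisibility using (_∣_; divides; _∣0; n∣n; ∣1⇒≡1; ∣m∣n⇒∣m+n; ∣m+n∣m⇒∣n)
open import Data.Product using (∃-syntax; _×_; _,_)
open import Data.Empty using (⊥-elim)
open import Relation.Nullary using (¬_; yes; no)
open import Relation.Binary.PropositionalEquality
open import Algebra.Properties.CommutativeSemigroup +-commutativeSemigroup using (xy∙z≈xz∙y; x∙yz≈xz∙y)

sumUpTo-cong : ∀ n {f g : ℕ → ℕ} → (∀ x → f x ≡ g x) → sumUpTo n f ≡ sumUpTo n g
sumUpTo-cong zero    f≗g = f≗g 0
sumUpTo-cong (suc n) f≗g = cong₂ _+_ (sumUpTo-cong n f≗g) (f≗g (suc n))

sumUpTo-suc : ∀ n f → sumUpTo (suc n) f ≡ f 0 + sumUpTo n (λ x → f (suc x))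
sumUpTo-suc zero    f = refl
sumUpTo-suc (suc n) f = begin
  sumUpTo (suc n) f + f (suc (suc n))                        ≡⟨ cong (_+ f (suc (suc n))) (sumUpTo-suc n f) ⟩
  f 0 + sumUpTo n (λ x → f (suc x)) + f (suc (suc n))         ≡⟨ +-assoc (f 0) _ _ ⟩
  f 0 + sumUpTo (suc n) (λ x → f (suc x))                    ∎
  where open ≡-Reasoning

sumUpTo-vanishing-tail : ∀ {M N} f → M ≤ N → (∀ y → M < y → f y ≡ 0) → sumUpTo N f ≡ sumUpTo M f
sumUpTo-vanishing-tail {M} f M≤N tail = go (≤⇒≤′ M≤N)
  where
  go : ∀ {N} → M ≤′ N → sumUpTo N f ≡ sumUpTo M f
  go ≤′-refl                = refl
  go (≤′-step {N} M≤′N) = begin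
    sumUpTo N f + f (suc N)  ≡⟨ cong₂ _+_ (go M≤′N) (tail (suc N) (s≤s (≤′⇒≤ M≤′N))) ⟩
    sumUpTo M f + 0          ≡⟨ +-identityʳ _ ⟩
    sumUpTo M f              ∎
    where open ≡-Reasoning

-- The summand in the definition of pA is bound in an anonymous where block; this extracts it,
-- by unification, from the definitional unfolding of a sum.
definingSummand : ∀ n {f : ℕ → ℕ} {v : ℕ} → v ≡ sumUpTo n f → ℕ → ℕ
definingSummand n {f} _ = f

module _ (a : ℕ → ℕ) (k : ℕ) where

  summand : ℕ → ℕ → ℕ
  summand n x with x * a k ≤? n
  ... | yes _ = pA a (n ∸ x * a k) k
  ... | no  _ = 0

  pA-suc : ∀ n → pA a n (suc k) ≡ sumUpTo n (summand n)
  pA-suc zero    = refl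
  pA-suc (suc n) = sumUpTo-cong (suc n) definingSummand≗summand
    where
    definingSummand≗summand : ∀ x → definingSummand (suc n) {v = pA a (suc n) (suc k)} refl x ≡ summand (suc n) x
    definingSummand≗summand x with x * a k ≤? suc n
    ... | yes _ = refl
    ... | no  _ = refl

  summand-beyond : ∀ {n} x → n < x * a k → summand n x ≡ 0
  summand-beyond {n} x n<xa with x * a k ≤? n
  ... | yes xa≤n = ⊥-elim (<⇒≱ n<xa xa≤n)
  ... | no  _    = refl

  summand-suc : ∀ {n} x → a k ≤ n → summand n (suc x) ≡ summand (n ∸ a k) x
  summand-suc {n} x a≤n with suc x * a k ≤? n | x * a k ≤? n ∸ a k
  ... | yes _     | yes _      = cong (λ t → pA a t k) (sym (∸-+-assoc n (a k) (x * a k)))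
  ... | yes sxa≤n | no xa≰n∸a  = ⊥-elim (xa≰n∸a (begin
        x * a k              ≡⟨ m+n∸m≡n (a k) (x * a k) ⟨
        suc x * a k ∸ a k    ≤⟨ ∸-monoˡ-≤ (a k) sxa≤n ⟩
        n ∸ a k              ∎))
    where open ≤-Reasoning
  ... | no sxa≰n  | yes xa≤n∸a = ⊥-elim (sxa≰n (begin
        a k + x * a k        ≤⟨ +-monoʳ-≤ (a k) xa≤n∸a ⟩
        a k + (n ∸ a k)      ≡⟨ m+[n∸m]≡n a≤n ⟩
        n                    ∎))
    where open ≤-Reasoning
  ... | no _      | no _       = refl

  module _ (a>0 : 0 < a k) where

    pA-suc-sumUpTo : ∀ {n N} → n ≤ N → pA a n (suc k) ≡ sumUpTo N (summand n)
    pA-suc-sumUpTo {n} n≤N = trans (pA-suc n) (sym (sumUpTo-vanishing-tail (summand n) n≤N vanishes))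
      where
      vanishes : ∀ x → n < x → summand n x ≡ 0
      vanishes x n<x = summand-beyond x (<-≤-trans n<x (m≤m*n x (a k) {{>-nonZero a>0}}))

    pA-suc-recurrence : ∀ {n} → a k ≤ n → pA a n (suc k) ≡ pA a n k + pA a (n ∸ a k) (suc k)
    pA-suc-recurrence {zero}  a≤0 = ⊥-elim (<⇒≱ a>0 a≤0)
    pA-suc-recurrence {suc n} a≤n = begin
      pA a (suc n) (suc k)                                       ≡⟨ pA-suc (suc n) ⟩
      sumUpTo (suc n) (summand (suc n))                          ≡⟨ sumUpTo-suc n _ ⟩
      pA a (suc n) k + sumUpTo n (λ x → summand (suc n) (suc x)) ≡⟨ cong (pA a (suc n) k +_) (sumUpTo-cong n (λ x → summand-suc x a≤n)) ⟩
      pA a (suc n) k + sumUpTo n (summand (suc n ∸ a k))         ≡⟨ cong (pA a (suc n) k +_) (pA-suc-sumUpTo (∸-monoʳ-≤ (suc n) a>0)) ⟨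
      pA a (suc n) k + pA a (suc n ∸ a k) (suc k)                ∎
      where open ≡-Reasoning

pA-zero-pos : ∀ a {n} → 0 < n → pA a n 0 ≡ 0
pA-zero-pos a {suc n} _ = refl

pA-one-multiple : ∀ a → 0 < a 0 → ∀ q → pA a (q * a 0) 1 ≡ 1
pA-one-multiple a a>0 zero    = refl
pA-one-multiple a a>0 (suc q) = begin
  pA a (a 0 + q * a 0) 1                             ≡⟨ pA-suc-recurrence a 0 a>0 (m≤m+n (a 0) (q * a 0)) ⟩
  pA a (a 0 + q * a 0) 0 + pA a (a 0 + q * a 0 ∸ a 0) 1 ≡⟨ cong₂ _+_ (pA-zero-pos a (<-≤-trans a>0 (m≤m+n (a 0) (q * a 0))))
                                                                   (cong (λ t → pA a t 1) (m+n∸m≡n (a 0) (q * a 0))) ⟩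
  pA a (q * a 0) 1                                   ≡⟨ pA-one-multiple a a>0 q ⟩
  1                                                  ∎
  where open ≡-Reasoning

window-contains-multiple : ∀ {d} → 0 < d → ∀ n → ∃[ j ] j < d × d ∣ n + j
window-contains-multiple {suc c} _ zero = 0 , s≤s z≤n , suc c ∣0
window-contains-multiple {suc c} d>0 (suc n) with window-contains-multiple d>0 n
... | suc j , s≤s j<c , d∣n+j = j , m≤n⇒m≤1+n j<c , subst (suc c ∣_) (+-suc n j) d∣n+j
... | zero  , _       , d∣n+0 =
  c , n<1+n c , subst (suc c ∣_) (+-suc n c) (∣m∣n⇒∣m+n (subst (suc c ∣_) (+-identityʳ n) d∣n+0) n∣n)

module _ (a : ℕ → ℕ) {m : ℕ} where

  no-divisible-window-one : 0 < a 0 → ¬ m ∣ 1 → ∀ n₀ → ¬ (∀ j → j < a 0 → m ∣ pA a (n₀ + j) 1)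
  no-divisible-window-one a>0 m∤1 n₀ window with window-contains-multiple a>0 n₀
  ... | j , j<a , divides q n₀+j≡qa =
    m∤1 (subst (m ∣_) (trans (cong (λ t → pA a t 1) n₀+j≡qa) (pA-one-multiple a a>0 q)) (window j j<a))

  divisible-window-descend : ∀ {k} → 0 < a k → ∀ ℓ n₀ →
    (∀ j → j < ℓ + a k → m ∣ pA a (n₀ + j) (suc k)) →
    ∀ j → j < ℓ → m ∣ pA a (n₀ + a k + j) k
  divisible-window-descend {k} a>0 ℓ n₀ window j j<ℓ =
    ∣m+n∣m⇒∣n (subst (m ∣_) (+-comm (pA a n k) _) m∣sum) m∣tail
    where
    n = n₀ + a k + j
    n∸a≡n₀+j : n ∸ a k ≡ n₀ + j
    n∸a≡n₀+j = trans (cong (_∸ a k) (xy∙z≈xz∙y n₀ (a k) j)) (m+n∸n≡m (n₀ + j) (a k))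
    m∣sum : m ∣ pA a n k + pA a (n ∸ a k) (suc k)
    m∣sum = subst (m ∣_) (pA-suc-recurrence a k a>0 (≤-trans (m≤n+m (a k) n₀) (m≤m+n _ j)))
              (subst (λ t → m ∣ pA a t (suc k)) (x∙yz≈xz∙y n₀ j (a k)) (window (j + a k) (+-monoˡ-< (a k) j<ℓ)))
    m∣tail : m ∣ pA a (n ∸ a k) (suc k)
    m∣tail = subst (λ t → m ∣ pA a t (suc k)) (sym n∸a≡n₀+j) (window j (≤-trans j<ℓ (m≤m+n ℓ (a k))))

  no-divisible-window : (∀ i → 0 < a i) → 1 < m → ∀ k n₀ →
    ¬ (∀ j → j < sumA a (suc k) → m ∣ pA a (n₀ + j) (suc k))
  no-divisible-window a>0 m>1 zero    n₀ = no-divisible-window-one (a>0 0) m∤1 n₀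
    where
    m∤1 : ¬ m ∣ 1
    m∤1 m∣1 = <⇒≢ m>1 (sym (∣1⇒≡1 m∣1))
  no-divisible-window a>0 m>1 (suc k) n₀ window =
    no-divisible-window a>0 m>1 k (n₀ + a (suc k))
      (divisible-window-descend (a>0 (suc k)) (sumA a (suc k)) n₀ window)

theorem5p1 : (a : ℕ → ℕ) → (∀ i → 0 < a i) →
    (k : ℕ) → 1 ≤ k → (m : ℕ) → 2 ≤ m →
    ¬ (∃[ n₀ ] (∀ j → j < sumA a k → m ∣ pA a (n₀ + j) k))
theorem5p1 a a>0 (suc k) _ m m≥2 (n₀ , window) = no-divisible-window a a>0 m≥2 k n₀ window
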